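{- Let $G$ be a finite group. The undirected power graph $\mathrm{Pow}(G)$ can be reconstructed from the cyclic subgroup lattice $\mathcal{L}_c(G)$. In particular, if $H$ is a finite group with $\mathcal{L}_c(G)\cong\mathcal{L}_c(H)$, then $\mathrm{Pow}(G)\cong\mathrm{Pow}(H)$.
   Context: $\mathcal{L}_c(G)$ is the set of cyclic subgroups of $G$ ordered by inclusion, identified with its Hasse diagram, each vertex labelled by the order of the corresponding subgroup; an isomorphism of such lattices is an order-isomorphism preserving these order labels. The power graph $\mathrm{Pow}(G)$ is the simple graph with vertex set $G$ in which distinct $x,y$ are adjacent iff one of them is a power of the other. -}

module Defs where

open import Data.Nat using (ℕ; zero; suc)
open import Data.Fin using (Fin; toℕ)
open import Data.Fin.Properties using (any?) renaming (_≟_ to _≟ᶠ_)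
open import Data.Fin.Subset using (Subset; _⊆_; ∣_∣)
open import Data.Vec using (tabulate)
open import Data.Product using (Σ; ∃; ∃-syntax; _×_; proj₁)
open import Data.Sum using (_⊎_)
open import Relation.Nullary using (¬_; does)
open import Relation.Binary.PropositionalEquality using (_≡_)
open import Algebra.Structures using (IsGroup)
open import Function.Bundles using (_⇔_; _↔_; Inverse)
open import Function.Base using (_∘_)

-- A finite group: carrier Fin order (every finite group is isomorphic to one of these),
-- with equality the propositional one.
record FiniteGroup : Set where
  field
    order   : ℕ
    _∙_     : Fin order → Fin order → Fin order
    ε       : Fin order
    _⁻¹     : Fin order → Fin order
    isGroup : IsGroup _≡_ _∙_ ε _⁻¹

module _ (G : FiniteGroup) where
  open FiniteGroup G

  pow : Fin order → ℕ → Fin order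
  pow x zero    = ε
  pow x (suc k) = x ∙ pow x k

  -- the cyclic subgroup ⟨x⟩ = { x^k } as a subset of G;
  -- exponents k < |G| suffice since G is finite (x^{ord x} = ε, ord x ≤ |G|)
  ⟨_⟩ : Fin order → Subset order
  ⟨ x ⟩ = tabulate (λ g → does (any? {n = order} (λ k → pow x (toℕ k) ≟ᶠ g)))

  CycSub : Set
  CycSub = Σ (Subset order) (λ S → ∃[ x ] S ≡ ⟨ x ⟩)

  PowAdj : Fin order → Fin order → Set
  PowAdj x y = ¬ (x ≡ y) × ((∃[ k ] y ≡ pow x k) ⊎ (∃[ k ] x ≡ pow y k))

-- isomorphism of the labelled lattices L_c(G) ≅ L_c(H):
-- mutually inverse maps that preserve and reflect inclusion and preserve the order labels
record LcIso (G H : FiniteGroup) : Set where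
  field
    to       : CycSub G → CycSub H
    from     : CycSub H → CycSub G
    from∘to  : ∀ A → proj₁ (from (to A)) ≡ proj₁ A
    to∘from  : ∀ B → proj₁ (to (from B)) ≡ proj₁ B
    mono     : ∀ A A′ → (proj₁ A ⊆ proj₁ A′) ⇔ (proj₁ (to A) ⊆ proj₁ (to A′))
    label    : ∀ A → ∣ proj₁ (to A) ∣ ≡ ∣ proj₁ A ∣

record PowIso (G H : FiniteGroup) : Set where
  field
    bij : Fin (FiniteGroup.order G) ↔ Fin (FiniteGroup.order H)
    adj : ∀ x y → PowAdj G x y ⇔ PowAdj H (Inverse.to bij x) (Inverse.to bij y)

-- Every element x of a cyclic subgroup C satisfies ⟨x⟩ ⊆ C, so grouping the |C| elements of C by the
-- cyclic subgroup they generate shows that the number of generators of C is |C| minus the total number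
-- of generators of the cyclic subgroups strictly below C. An isomorphism of labelled lattices preserves
-- both the orders and the order relation, so by induction on |C| the subgroup C and its image have
-- equally many generators. Matching generators gives a bijection π : G → H with
-- ⟨y⟩ ⊆ ⟨x⟩ ⟺ ⟨π y⟩ ⊆ ⟨π x⟩, and y is a power of x exactly when ⟨y⟩ ⊆ ⟨x⟩.

module Submission where

open import Defs renaming (⟨_⟩ to _⟨_⟩)

open import Algebra.Bundles using (Group)
open import Data.Bool.Base using (if_then_else_)
import Data.Bool.Properties as Bool
open import Data.Empty using (⊥-elim)
open import Data.Fin.Base using (Fin; zero; suc; toℕ; fromℕ<; punchIn)
open import Data.Fin.Permutation using (Permutation; _⟨$⟩ʳ_; insert; insert-punchIn)
import Data.Fin.Permutation as Permutation
open import Data.Fin.Properties using (¬Fin0; any?; pigeonhole; toℕ≤pred[n]; toℕ-fromℕ<)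
  renaming (_≟_ to _≟ᶠ_)
open import Data.Fin.Subset using (Subset; _⊆_; _⊂_; _∈_; ∣_∣; inside; outside)
open import Data.Fin.Subset.Properties
  using (_∈?_; _⊆?_; _⊂?_; ⊆-refl; ⊆-antisym; ⊂-irref; p⊂q⇒∣p∣<∣q∣; ∣p∣≤n)
open import Data.Nat.Base using (ℕ; zero; suc; _+_; _*_; _≤_; _<_; s≤s; z<s)
open import Data.Nat.DivMod using (_%_; _/_; m≡m%n+[m/n]*n; m%n<n)
open import Data.Nat.Properties
  using (+-0-commutativeMonoid; +-comm; n<1+n; +-cancelˡ-≡; +-cancelʳ-≡; ≤-trans; <-≤-trans;
         m≤m+n; n≤0⇒n≡0; ≮⇒≥; m≤n⇒∃[o]m+o≡n)
open import Algebra.Properties.CommutativeMonoid.Sum +-0-commutativeMonoid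
  using (sum; sum-cong-≗; ∑-distrib-+; sum-remove)
open import Data.Product using (Σ; ∃-syntax; _×_; _,_; proj₁; uncurry)
open import Data.Product.Function.NonDependent.Propositional using (_×-⇔_)
open import Data.Sum using (_⊎_; inj₁; inj₂; [_,_])
open import Data.Sum.Function.Propositional using (_⊎-⇔_)
open import Data.Vec.Base using ([]; _∷_)
open import Data.Vec.Properties using (≡-dec; lookup∘tabulate; []=⇒lookup; lookup⇒[]=)
open import Function.Base using (_∘_)
open import Function.Bundles using (_⇔_; mk⇔; Equivalence; Injection; Inverse; _↔_)
open import Function.Properties.Inverse using (↔⇒↣)
import Function.Properties.Equivalence as ⇔
open import Level using (Level; 0ℓ)
open import Relation.Binary.Definitions using (DecidableEquality)
open import Relation.Binary.PropositionalEquality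
  using (_≡_; _≢_; refl; sym; trans; cong; subst; subst₂; module ≡-Reasoning)
open import Relation.Nullary using (¬_; Dec; yes; no; does)
open import Relation.Nullary.Decidable
  using (dec-true; dec-false; does-⇔; decidable-stable; _×-dec_; ¬?)
open import Relation.Unary using (Pred; Decidable; U)

private
  variable
    ℓ : Level
    n m : ℕ
    A : Set ℓ
    X : Set

indicator : Dec A → ℕ
indicator a? = if does a? then 1 else 0

indicator-yes : (a? : Dec A) → A → indicator a? ≡ 1
indicator-yes a? a = cong (if_then 1 else 0) (dec-true a? a)

indicator-no : (a? : Dec A) → ¬ A → indicator a? ≡ 0
indicator-no a? ¬a = cong (if_then 1 else 0) (dec-false a? ¬a)

count : {P : Pred (Fin n) ℓ} → Decidable P → ℕ
count P? = sum (indicator ∘ P?)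

count-cong : {P Q : Pred (Fin n) ℓ} → (∀ i → P i ⇔ Q i) →
             (P? : Decidable P) (Q? : Decidable Q) → count P? ≡ count Q?
count-cong {n = n} P⇔Q P? Q? =
  sum-cong-≗ {n} λ i → cong (if_then 1 else 0) (does-⇔ (P⇔Q i) (P? i) (Q? i))

count-⊎ : {P Q R : Pred (Fin n) ℓ} → (∀ i → P i ⇔ (Q i ⊎ R i)) → (∀ i → Q i → ¬ R i) →
          (P? : Decidable P) (Q? : Decidable Q) (R? : Decidable R) →
          count P? ≡ count Q? + count R?
count-⊎ {n = n} P⇔Q⊎R disjoint P? Q? R? =
  trans (sum-cong-≗ {n} pointwise) (∑-distrib-+ (indicator ∘ Q?) (indicator ∘ R?))
  where
  pointwise : ∀ i → indicator (P? i) ≡ indicator (Q? i) + indicator (R? i)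
  pointwise i with Q? i | R? i
  ... | yes q | yes r = ⊥-elim (disjoint i q r)
  ... | yes q | no _  = indicator-yes (P? i) (Equivalence.from (P⇔Q⊎R i) (inj₁ q))
  ... | no _  | yes r = indicator-yes (P? i) (Equivalence.from (P⇔Q⊎R i) (inj₂ r))
  ... | no ¬q | no ¬r = indicator-no (P? i) ([ ¬q , ¬r ] ∘ Equivalence.to (P⇔Q⊎R i))

count-pos⇒∃ : {P : Pred (Fin n) ℓ} (P? : Decidable P) → 0 < count P? → ∃[ i ] P i
count-pos⇒∃ {n = suc n} P? pos with P? zero
... | yes P0 = zero , P0
... | no _   = let i , Pi = count-pos⇒∃ (P? ∘ suc) pos in suc i , Pi

count-none : {P : Pred (Fin n) ℓ} (P? : Decidable P) → (∀ i → ¬ P i) → count P? ≡ 0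
count-none P? none = n≤0⇒n≡0 (≮⇒≥ (λ pos → uncurry none (count-pos⇒∃ P? pos)))

module _ {P : Pred (Fin (suc n)) ℓ} (P? : Decidable P) where

  count-removeAt : ∀ j → count P? ≡ indicator (P? j) + count (P? ∘ punchIn j)
  count-removeAt j = sum-remove {n} (indicator ∘ P?)

  count-removeAt-yes : ∀ {j} → P j → count P? ≡ suc (count (P? ∘ punchIn j))
  count-removeAt-yes {j} Pj =
    trans (count-removeAt j) (cong (_+ count (P? ∘ punchIn j)) (indicator-yes (P? j) Pj))

∃⇒count-pos : {P : Pred (Fin n) ℓ} (P? : Decidable P) → ∀ {j} → P j → 0 < count P?
∃⇒count-pos {n = suc n} P? Pj = subst (0 <_) (sym (count-removeAt-yes P? Pj)) z<s

∣p∣≡count-∈ : (p : Subset n) → ∣ p ∣ ≡ count (_∈? p)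
∣p∣≡count-∈ []            = refl
∣p∣≡count-∈ (inside ∷ p)  = cong suc (∣p∣≡count-∈ p)
∣p∣≡count-∈ (outside ∷ p) = ∣p∣≡count-∈ p

_≟ˢ_ : DecidableEquality (Subset n)
_≟ˢ_ = ≡-dec Bool._≟_

p⊆q∧p≢q⇒p⊂q : {p q : Subset n} → p ⊆ q → p ≢ q → p ⊂ q
p⊆q∧p≢q⇒p⊂q {p = p} {q} p⊆q p≢q with any? (λ x → x ∈? q ×-dec ¬? (x ∈? p))
... | yes witness = p⊆q , witness
... | no ∄witness = ⊥-elim (p≢q (⊆-antisym p⊆q q⊆p))
  where
  q⊆p : q ⊆ p
  q⊆p {x} x∈q = decidable-stable (x ∈? p) (λ x∉p → ∄witness (x , x∈q , x∉p))

p⊆q⇔p≡q⊎p⊂q : {p q : Subset n} → p ⊆ q ⇔ (p ≡ q ⊎ p ⊂ q)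
p⊆q⇔p≡q⊎p⊂q {p = p} {q} = mk⇔ to from
  where
  to : p ⊆ q → p ≡ q ⊎ p ⊂ q
  to p⊆q with p ≟ˢ q
  ... | yes p≡q = inj₁ p≡q
  ... | no p≢q  = inj₂ (p⊆q∧p≢q⇒p⊂q p⊆q p≢q)
  from : p ≡ q ⊎ p ⊂ q → p ⊆ q
  from (inj₁ refl) = ⊆-refl
  from (inj₂ p⊂q)  = proj₁ p⊂q

count-⊆-split : ∀ {N} (f : Fin n → Subset N) S →
          count (λ i → f i ⊆? S) ≡ count (λ i → f i ≟ˢ S) + count (λ i → f i ⊂? S)
count-⊆-split f S = count-⊎ (λ _ → p⊆q⇔p≡q⊎p⊂q) (λ { _ refl → ⊂-irref refl })
                      (λ i → f i ⊆? S) (λ i → f i ≟ˢ S) (λ i → f i ⊂? S)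

module _ (_≟_ : DecidableEquality X) where

  fibreSize : (Fin n → X) → X → ℕ
  fibreSize p x = count (λ i → p i ≟ x)

  FibresAgreeOn : Pred X ℓ → (Fin n → X) → (Fin m → X) → Set ℓ
  FibresAgreeOn P p q = (∀ i → P (p i) → fibreSize p (p i) ≡ fibreSize q (p i))
                      × (∀ j → P (q j) → fibreSize p (q j) ≡ fibreSize q (q j))

  FibresAgree : (Fin n → X) → (Fin m → X) → Set
  FibresAgree = FibresAgreeOn U

  module _ {P : Pred X ℓ} where

    FibresAgreeOn-sym : {p : Fin n → X} {q : Fin m → X} → FibresAgreeOn P p q → FibresAgreeOn P q p
    FibresAgreeOn-sym (p-agree , q-agree) = (λ j → sym ∘ q-agree j) , (λ i → sym ∘ p-agree i)

    fibreSize-self-pos : (p : Fin n → X) → ∀ i → 0 < fibreSize p (p i)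
    fibreSize-self-pos p i = ∃⇒count-pos (λ k → p k ≟ p i) refl

    FibresAgreeOn⇒matched : {p : Fin n → X} {q : Fin m → X} → FibresAgreeOn P p q →
                            ∀ {i} → P (p i) → ∃[ j ] q j ≡ p i
    FibresAgreeOn⇒matched {p = p} {q} (p-agree , _) {i} Ppi =
      count-pos⇒∃ (λ j → q j ≟ p i) (subst (0 <_) (p-agree i Ppi) (fibreSize-self-pos p i))

    FibresAgreeOn-removeMatched : {p : Fin (suc n) → X} {q : Fin (suc m) → X} →
                                  FibresAgreeOn P p q → ∀ {j} → q j ≡ p zero →
                                  FibresAgreeOn P (p ∘ suc) (q ∘ punchIn j)
    FibresAgreeOn-removeMatched {p = p} {q} (p-agree , q-agree) {j} qj≡p0 =
        (λ i → removed (p (suc i)) ∘ p-agree (suc i))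
      , (λ k → removed (q (punchIn j k)) ∘ q-agree (punchIn j k))
      where
      removed : ∀ x → fibreSize p x ≡ fibreSize q x → fibreSize (p ∘ suc) x ≡ fibreSize (q ∘ punchIn j) x
      removed x agree = +-cancelˡ-≡ (indicator (p zero ≟ x)) _ _ (begin
        indicator (p zero ≟ x) + fibreSize (p ∘ suc) x       ≡⟨ agree ⟩
        fibreSize q x                                        ≡⟨ count-removeAt (λ k → q k ≟ x) j ⟩
        indicator (q j ≟ x) + fibreSize (q ∘ punchIn j) x    ≡⟨ cong (λ y → indicator (y ≟ x) + _) qj≡p0 ⟩
        indicator (p zero ≟ x) + fibreSize (q ∘ punchIn j) x ∎)
        where open ≡-Reasoning

    FibresAgreeOn-removeUnmatched : {p : Fin (suc n) → X} {q : Fin m → X} →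
                                    FibresAgreeOn P p q → ¬ P (p zero) → FibresAgreeOn P (p ∘ suc) q
    FibresAgreeOn-removeUnmatched {p = p} {q} (p-agree , q-agree) ¬Pp0 =
        (λ i Ppi → trans (removed Ppi) (p-agree (suc i) Ppi))
      , (λ j Pqj → trans (removed Pqj) (q-agree j Pqj))
      where
      removed : ∀ {x} → P x → fibreSize (p ∘ suc) x ≡ fibreSize p x
      removed {x} Px =
        sym (cong (_+ fibreSize (p ∘ suc) x) (indicator-no (p zero ≟ x) λ { refl → ¬Pp0 Px }))

    FibresAgreeOn-emptyʳ : {p : Fin n → X} {q : Fin 0 → X} → FibresAgreeOn P p q → ∀ i → ¬ P (p i)
    FibresAgreeOn-emptyʳ agree i Ppi = ¬Fin0 (proj₁ (FibresAgreeOn⇒matched agree Ppi))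

    FibresAgreeOn⇒count≡ : (P? : Decidable P) {p : Fin n → X} {q : Fin m → X} →
                           FibresAgreeOn P p q → count (P? ∘ p) ≡ count (P? ∘ q)
    FibresAgreeOn⇒count≡ {zero}  {m}     P? agree =
      sym (count-none (P? ∘ _) (FibresAgreeOn-emptyʳ (FibresAgreeOn-sym agree)))
    FibresAgreeOn⇒count≡ {suc n} {zero}  P? {p} agree = count-none (P? ∘ p) (FibresAgreeOn-emptyʳ agree)
    FibresAgreeOn⇒count≡ {suc n} {suc m} P? {p} {q} agree with P? (p zero)
    ... | no ¬Pp0 = FibresAgreeOn⇒count≡ P? (FibresAgreeOn-removeUnmatched agree ¬Pp0)
    ... | yes Pp0 with j , qj≡p0 ← FibresAgreeOn⇒matched agree Pp0 = begin
      suc (count (P? ∘ p ∘ suc))       ≡⟨ cong suc (FibresAgreeOn⇒count≡ P? rest-agree) ⟩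
      suc (count (P? ∘ q ∘ punchIn j)) ≡⟨ count-removeAt-yes (P? ∘ q) (subst P (sym qj≡p0) Pp0) ⟨
      count (P? ∘ q)                   ∎
      where
      open ≡-Reasoning
      rest-agree : FibresAgreeOn P (p ∘ suc) (q ∘ punchIn j)
      rest-agree = FibresAgreeOn-removeMatched agree qj≡p0

  FibresAgree⇒permutation : {p : Fin n → X} {q : Fin m → X} → FibresAgree p q →
                            Σ (Permutation n m) λ π → ∀ i → q (π ⟨$⟩ʳ i) ≡ p i
  FibresAgree⇒permutation {zero}  {zero}  agree = Permutation.id , λ ()
  FibresAgree⇒permutation {zero}  {suc m} agree =
    ⊥-elim (FibresAgreeOn-emptyʳ (FibresAgreeOn-sym agree) zero _)
  FibresAgree⇒permutation {suc n} {zero}  agree = ⊥-elim (FibresAgreeOn-emptyʳ agree zero _)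
  FibresAgree⇒permutation {suc n} {suc m} {q = q} agree
    with j , qj≡p0 ← FibresAgreeOn⇒matched agree _
    with π , qπ≡p ← FibresAgree⇒permutation (FibresAgreeOn-removeMatched agree qj≡p0) =
    insert zero j π , λ { zero    → qj≡p0
                        ; (suc i) → trans (cong q (insert-punchIn zero j π i)) (qπ≡p i) }

module _ (G : FiniteGroup) where
  open FiniteGroup G
  private
    group : Group 0ℓ 0ℓ
    group = record { isGroup = isGroup }

  open Group group using (assoc; identityˡ; identityʳ)
  open import Algebra.Properties.Group group using (∙-cancelʳ)

  pow-+ : ∀ x a b → pow G x (a + b) ≡ pow G x a ∙ pow G x b
  pow-+ x zero    b = sym (identityˡ _)
  pow-+ x (suc a) b = trans (cong (x ∙_) (pow-+ x a b)) (sym (assoc x _ _))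

  pow-* : ∀ x a b → pow G (pow G x a) b ≡ pow G x (b * a)
  pow-* x a zero    = refl
  pow-* x a (suc b) = trans (cong (pow G x a ∙_) (pow-* x a b)) (sym (pow-+ x a (b * a)))

  pow-ε : ∀ b → pow G ε b ≡ ε
  pow-ε zero    = refl
  pow-ε (suc b) = trans (identityˡ _) (pow-ε b)

  pow-period : ∀ x → ∃[ e ] pow G x (suc e) ≡ ε × suc e ≤ order
  pow-period x with i , j , i<j , xⁱ≡xʲ ← pigeonhole (n<1+n order) (λ i → pow G x (toℕ i))
           with o , i+1+o≡j ← m≤n⇒∃[o]m+o≡n i<j = o , x¹⁺ᵒ≡ε , 1+o≤order
    where
    open ≡-Reasoning
    j≡1+o+i : toℕ j ≡ suc o + toℕ i
    j≡1+o+i = trans (sym i+1+o≡j) (cong suc (+-comm (toℕ i) o))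
    x¹⁺ᵒ≡ε : pow G x (suc o) ≡ ε
    x¹⁺ᵒ≡ε = ∙-cancelʳ (pow G x (toℕ i)) _ _ (begin
      pow G x (suc o) ∙ pow G x (toℕ i) ≡⟨ pow-+ x (suc o) (toℕ i) ⟨
      pow G x (suc o + toℕ i)           ≡⟨ cong (pow G x) j≡1+o+i ⟨
      pow G x (toℕ j)                   ≡⟨ xⁱ≡xʲ ⟨
      pow G x (toℕ i)                   ≡⟨ identityˡ _ ⟨
      ε ∙ pow G x (toℕ i)               ∎)
    1+o≤order : suc o ≤ order
    1+o≤order = ≤-trans (m≤m+n (suc o) (toℕ i)) (subst (_≤ order) j≡1+o+i (toℕ≤pred[n] j))

  pow-mod-period : ∀ {x e} → pow G x (suc e) ≡ ε → ∀ k → pow G x k ≡ pow G x (k % suc e)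
  pow-mod-period {x} {e} xᴱ≡ε k = begin
    pow G x k                                   ≡⟨ cong (pow G x) (m≡m%n+[m/n]*n k E) ⟩
    pow G x (k % E + k / E * E)                 ≡⟨ pow-+ x (k % E) _ ⟩
    pow G x (k % E) ∙ pow G x (k / E * E)       ≡⟨ cong (pow G x (k % E) ∙_) (pow-* x E (k / E)) ⟨
    pow G x (k % E) ∙ pow G (pow G x E) (k / E) ≡⟨ cong (λ y → pow G x (k % E) ∙ pow G y (k / E)) xᴱ≡ε ⟩
    pow G x (k % E) ∙ pow G ε (k / E)           ≡⟨ cong (pow G x (k % E) ∙_) (pow-ε (k / E)) ⟩
    pow G x (k % E) ∙ ε                         ≡⟨ identityʳ _ ⟩
    pow G x (k % E)                             ∎
    where
    open ≡-Reasoning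
    E : ℕ
    E = suc e

  pow-bounded-exponent : ∀ x k → ∃[ r ] pow G x k ≡ pow G x (toℕ {order} r)
  pow-bounded-exponent x k with e , xᴱ≡ε , E≤order ← pow-period x =
    fromℕ< k%E<order , trans (pow-mod-period xᴱ≡ε k) (cong (pow G x) (sym (toℕ-fromℕ< k%E<order)))
    where
    k%E<order : k % suc e < order
    k%E<order = <-≤-trans (m%n<n k (suc e)) E≤order

  ∈⟨⟩⇔power : ∀ {x y} → y ∈ G ⟨ x ⟩ ⇔ (∃[ k ] y ≡ pow G x k)
  ∈⟨⟩⇔power {x} {y} = mk⇔ to from
    where
    search : Dec (∃[ k ] pow G x (toℕ {order} k) ≡ y)
    search = any? (λ k → pow G x (toℕ k) ≟ᶠ y)
    to : y ∈ G ⟨ x ⟩ → ∃[ k ] y ≡ pow G x k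
    to y∈ with search | trans (sym (lookup∘tabulate _ y)) ([]=⇒lookup y∈)
    ... | yes (k , xᵏ≡y) | _  = toℕ k , sym xᵏ≡y
    ... | no _           | ()
    from : ∃[ k ] y ≡ pow G x k → y ∈ G ⟨ x ⟩
    from (k , y≡xᵏ) with r , xᵏ≡xʳ ← pow-bounded-exponent x k =
      lookup⇒[]= y (G ⟨ x ⟩) (trans (lookup∘tabulate _ y) (dec-true search (r , sym (trans y≡xᵏ xᵏ≡xʳ))))

  ⟨⟩⊆⟨⟩⇔∈ : ∀ {x y} → G ⟨ y ⟩ ⊆ G ⟨ x ⟩ ⇔ y ∈ G ⟨ x ⟩
  ⟨⟩⊆⟨⟩⇔∈ {x} {y} = mk⇔ (λ ⟨y⟩⊆⟨x⟩ → ⟨y⟩⊆⟨x⟩ y∈⟨y⟩) ⟨y⟩⊆⟨x⟩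
    where
    y∈⟨y⟩ : y ∈ G ⟨ y ⟩
    y∈⟨y⟩ = Equivalence.from ∈⟨⟩⇔power (1 , sym (identityʳ y))
    ⟨y⟩⊆⟨x⟩ : y ∈ G ⟨ x ⟩ → G ⟨ y ⟩ ⊆ G ⟨ x ⟩
    ⟨y⟩⊆⟨x⟩ y∈⟨x⟩ z∈⟨y⟩
      with a , y≡xᵃ ← Equivalence.to ∈⟨⟩⇔power y∈⟨x⟩
      with b , z≡yᵇ ← Equivalence.to ∈⟨⟩⇔power z∈⟨y⟩ =
      Equivalence.from ∈⟨⟩⇔power (b * a , trans z≡yᵇ (trans (cong (λ w → pow G w b) y≡xᵃ) (pow-* x a b)))

  ⟨⟩⊆⟨⟩⇔power : ∀ {x y} → G ⟨ y ⟩ ⊆ G ⟨ x ⟩ ⇔ (∃[ k ] y ≡ pow G x k)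
  ⟨⟩⊆⟨⟩⇔power = ⇔.trans ⟨⟩⊆⟨⟩⇔∈ ∈⟨⟩⇔power

  count-⊆-cyclic : (C : CycSub G) → count (λ x → G ⟨ x ⟩ ⊆? proj₁ C) ≡ ∣ proj₁ C ∣
  count-⊆-cyclic (_ , g , refl) =
    trans (count-cong (λ _ → ⟨⟩⊆⟨⟩⇔∈) (λ x → G ⟨ x ⟩ ⊆? G ⟨ g ⟩) (_∈? G ⟨ g ⟩))
          (sym (∣p∣≡count-∈ (G ⟨ g ⟩)))

cyclic : (G : FiniteGroup) → Fin (FiniteGroup.order G) → CycSub G
cyclic G x = G ⟨ x ⟩ , x , refl

module _ {G H : FiniteGroup} (iso : LcIso G H) where
  open LcIso iso
  private
    nG nH : ℕ
    nG = FiniteGroup.order G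
    nH = FiniteGroup.order H

  from⟨_⟩ : Fin nH → Subset nG
  from⟨ y ⟩ = proj₁ (from (cyclic H y))

  from⟨⟩⊆⇔ : ∀ y (C : CycSub G) → from⟨ y ⟩ ⊆ proj₁ C ⇔ H ⟨ y ⟩ ⊆ proj₁ (to C)
  from⟨⟩⊆⇔ y C = subst (λ T → from⟨ y ⟩ ⊆ proj₁ C ⇔ T ⊆ proj₁ (to C)) (to∘from (cyclic H y)) (mono _ C)

  from⟨⟩⊆from⟨⟩⇔ : ∀ y y′ → from⟨ y ⟩ ⊆ from⟨ y′ ⟩ ⇔ H ⟨ y ⟩ ⊆ H ⟨ y′ ⟩
  from⟨⟩⊆from⟨⟩⇔ y y′ =
    subst (λ T → from⟨ y ⟩ ⊆ from⟨ y′ ⟩ ⇔ H ⟨ y ⟩ ⊆ T) (to∘from (cyclic H y′))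
          (from⟨⟩⊆⇔ y (from (cyclic H y′)))

  count-from⟨⟩⊆ : (C : CycSub G) → count (λ y → from⟨ y ⟩ ⊆? proj₁ C) ≡ ∣ proj₁ C ∣
  count-from⟨⟩⊆ C =
    trans (count-cong (λ y → from⟨⟩⊆⇔ y C) (λ y → from⟨ y ⟩ ⊆? proj₁ C) (λ y → H ⟨ y ⟩ ⊆? proj₁ (to C)))
          (trans (count-⊆-cyclic H (to C)) (label C))

  fibres-agree-below : ∀ k (C : CycSub G) → ∣ proj₁ C ∣ < k →
                       fibreSize _≟ˢ_ (G ⟨_⟩) (proj₁ C) ≡ fibreSize _≟ˢ_ from⟨_⟩ (proj₁ C)
  fibres-agree-below (suc k) C@(S , _) (s≤s ∣S∣≤k) = +-cancelʳ-≡ (count (λ x → G ⟨ x ⟩ ⊂? S)) _ _ (begin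
    fibreSize _≟ˢ_ (G ⟨_⟩) S + count (λ x → G ⟨ x ⟩ ⊂? S)  ≡⟨ count-⊆-split (G ⟨_⟩) S ⟨
    count (λ x → G ⟨ x ⟩ ⊆? S)                               ≡⟨ count-⊆-cyclic G C ⟩
    ∣ S ∣                                                      ≡⟨ count-from⟨⟩⊆ C ⟨
    count (λ y → from⟨ y ⟩ ⊆? S)                              ≡⟨ count-⊆-split from⟨_⟩ S ⟩
    fibreSize _≟ˢ_ from⟨_⟩ S + count (λ y → from⟨ y ⟩ ⊂? S) ≡⟨ cong (fibreSize _≟ˢ_ from⟨_⟩ S +_) below ⟨
    fibreSize _≟ˢ_ from⟨_⟩ S + count (λ x → G ⟨ x ⟩ ⊂? S)   ∎)
    where
    open ≡-Reasoning
    smaller : ∀ {D} → D ⊂ S → ∣ D ∣ < k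
    smaller D⊂S = <-≤-trans (p⊂q⇒∣p∣<∣q∣ D⊂S) ∣S∣≤k
    below : count (λ x → G ⟨ x ⟩ ⊂? S) ≡ count (λ y → from⟨ y ⟩ ⊂? S)
    below = FibresAgreeOn⇒count≡ _≟ˢ_ (_⊂? S) {p = G ⟨_⟩} {q = from⟨_⟩}
      ( (λ x x⊂S → fibres-agree-below k (cyclic G x) (smaller x⊂S))
      , (λ y y⊂S → fibres-agree-below k (from (cyclic H y)) (smaller y⊂S)))

  fibres-agree : FibresAgree _≟ˢ_ (G ⟨_⟩) from⟨_⟩
  fibres-agree = (λ x _ → fibres-agree-below _ (cyclic G x) (s≤s (∣p∣≤n (G ⟨ x ⟩))))
               , (λ y _ → fibres-agree-below _ (from (cyclic H y)) (s≤s (∣p∣≤n from⟨ y ⟩)))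

  ⟨⟩⊆⟨⟩-transport : (π : Permutation nG nH) → (∀ x → from⟨ π ⟨$⟩ʳ x ⟩ ≡ G ⟨ x ⟩) →
                ∀ x y → G ⟨ y ⟩ ⊆ G ⟨ x ⟩ ⇔ H ⟨ π ⟨$⟩ʳ y ⟩ ⊆ H ⟨ π ⟨$⟩ʳ x ⟩
  ⟨⟩⊆⟨⟩-transport π from⟨π⟩≡⟨⟩ x y =
    subst₂ (λ A B → A ⊆ B ⇔ H ⟨ π ⟨$⟩ʳ y ⟩ ⊆ H ⟨ π ⟨$⟩ʳ x ⟩) (from⟨π⟩≡⟨⟩ y) (from⟨π⟩≡⟨⟩ x)
           (from⟨⟩⊆from⟨⟩⇔ (π ⟨$⟩ʳ y) (π ⟨$⟩ʳ x))

⟨⟩⊆-preserving⇒PowIso : {G H : FiniteGroup} (π : Fin (FiniteGroup.order G) ↔ Fin (FiniteGroup.order H)) →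
                        (∀ x y → G ⟨ y ⟩ ⊆ G ⟨ x ⟩ ⇔ H ⟨ Inverse.to π y ⟩ ⊆ H ⟨ Inverse.to π x ⟩) →
                        PowIso G H
⟨⟩⊆-preserving⇒PowIso {G} {H} π ⊆⇔ = record
  { bij = π
  ; adj = λ x y → ≢⇔ x y ×-⇔ (power⇔ x y ⊎-⇔ power⇔ y x)
  }
  where
  open Injection (↔⇒↣ π) using (to; injective)
  power⇔ : ∀ x y → (∃[ k ] y ≡ pow G x k) ⇔ (∃[ k ] to y ≡ pow H (to x) k)
  power⇔ x y = ⇔.trans (⇔.sym (⟨⟩⊆⟨⟩⇔power G)) (⇔.trans (⊆⇔ x y) (⟨⟩⊆⟨⟩⇔power H))
  ≢⇔ : ∀ x y → x ≢ y ⇔ to x ≢ to y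
  ≢⇔ x y = mk⇔ (λ x≢y → x≢y ∘ injective) (λ πx≢πy → πx≢πy ∘ cong to)

theorem4 : (G H : FiniteGroup) → LcIso G H → PowIso G H
theorem4 G H iso with π , from⟨π⟩≡⟨⟩ ← FibresAgree⇒permutation _≟ˢ_ (fibres-agree iso) =
  ⟨⟩⊆-preserving⇒PowIso π (⟨⟩⊆⟨⟩-transport iso π from⟨π⟩≡⟨⟩)
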